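{- Let $t\geq 3$ be an integer and let $G$ be a finite simple graph that is $K_{1,t}$-free. Then $\varphi(G)\leq (t-1)(\chi(G)-1)+1$.
   Context: $K_{1,t}$ denotes the star with $t$ leaves; $G$ is $K_{1,t}$-free if it contains no induced subgraph isomorphic to $K_{1,t}$. $\chi(G)$ is the chromatic number. A $b$-coloring of $G$ with $b$ colors is a proper coloring of $V(G)$ using exactly $b$ colors such that for every color $i$ there is a vertex of color $i$ (a representative) that has neighbors of all the other $b-1$ colors. The $b$-chromatic number $\varphi(G)$ is the largest $b$ for which $G$ admits a $b$-coloring with $b$ colors. -}

module Defs where

open import Data.Nat using (ℕ; _≤_; _<_)
open import Data.Fin using (Fin)
open import Data.Product using (Σ; ∃; _×_)
open import Relation.Nullary using (¬_; Dec)
open import Relation.Binary.PropositionalEquality using (_≡_)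
open import Function.Definitions using (Injective)
open import Level using (0ℓ)

record Graph (n : ℕ) : Set₁ where
  field
    Adj     : Fin n → Fin n → Set
    adj?    : (u v : Fin n) → Dec (Adj u v)
    sym     : ∀ {u v} → Adj u v → Adj v u
    irrefl  : ∀ {u} → ¬ Adj u u
open Graph public

-- G contains an induced K_{1,t}: a centre v and t distinct leaves,
-- each adjacent to v, pairwise non-adjacent.
-- (Leaves are automatically distinct from v by irreflexivity.)
HasInducedStar : ∀ {n} → Graph n → ℕ → Set
HasInducedStar {n} G t =
  Σ (Fin n) λ v → Σ (Fin t → Fin n) λ f →
    Injective _≡_ _≡_ f
    × (∀ i → Adj G v (f i))
    × (∀ i j → ¬ Adj G (f i) (f j))

K1-Free : ∀ {n} → Graph n → ℕ → Set
K1-Free G t = ¬ HasInducedStar G t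

IsProperColoring : ∀ {n} (G : Graph n) {k : ℕ} → (Fin n → Fin k) → Set
IsProperColoring {n} G c = ∀ (u v : Fin n) → Adj G u v → ¬ (c u ≡ c v)

Colorable : ∀ {n} → Graph n → ℕ → Set
Colorable {n} G k = Σ (Fin n → Fin k) λ c → IsProperColoring G c

IsChromaticNumber : ∀ {n} → Graph n → ℕ → Set
IsChromaticNumber G k = Colorable G k × (∀ m → m < k → ¬ Colorable G m)

IsBColoring : ∀ {n} (G : Graph n) (b : ℕ) → (Fin n → Fin b) → Set
IsBColoring {n} G b c =
  IsProperColoring G c
  × (∀ (i : Fin b) → ∃ λ v → c v ≡ i)
  × (∀ (i : Fin b) → Σ (Fin n) λ v → c v ≡ i ×
        (∀ (j : Fin b) → ¬ (j ≡ i) → Σ (Fin n) λ u → Adj G v u × c u ≡ j))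

HasBColoring : ∀ {n} → Graph n → ℕ → Set
HasBColoring {n} G b = Σ (Fin n → Fin b) λ c → IsBColoring G b c

IsBChromaticNumber : ∀ {n} → Graph n → ℕ → Set
IsBChromaticNumber G b = HasBColoring G b × (∀ m → b < m → ¬ HasBColoring G m)

{-# OPTIONS --safe #-}
-- A vertex v representing some colour of a b-colouring with φ colours has φ − 1 neighbours of
-- pairwise distinct colours. In a proper χ-colouring these neighbours avoid the colour of v, so
-- if φ − 1 > (t − 1)(χ − 1) then t of them share a colour by the pigeonhole principle; they are
-- pairwise non-adjacent and form an induced K_{1,t} with v.
module Submission where

open import Defs
open import Data.Nat using (ℕ; zero; suc; _≤_; _<_; _+_; _*_; _∸_; z≤n; s≤s)
open import Data.Nat.Properties using (+-suc; +-comm; *-comm; +-mono-≤; ≤-trans; ≤-reflexive; <⇒≱; ≰⇒>; ≮⇒≥; _<?_)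
open import Data.Fin using (Fin; zero; suc; punchIn; punchOut; inject≤)
open import Data.Fin.Properties using (_≟_; punchInᵢ≢i; punchIn-injective; punchOut-injective; inject≤-injective)
open import Data.List using (List; []; _∷_; length; filter; lookup; allFin)
open import Data.List.Properties using (length-tabulate)
open import Data.List.Relation.Unary.All as All using (All; _∷_)
open import Data.List.Relation.Unary.All.Properties using (all-filter; filter⁺; tabulate⁺)
open import Data.List.Relation.Unary.Unique.Propositional using (Unique; _∷_)
import Data.List.Relation.Unary.Unique.Propositional.Properties as Unique
open import Data.List.Relation.Unary.Any using (here; there)
open import Data.List.Relation.Binary.Sublist.Propositional using (_⊆_)
import Data.List.Relation.Binary.Sublist.Propositional.Properties as Sublist
open import Data.List.Membership.Propositional using (_∈_)
open import Data.List.Membership.Propositional.Properties using (∈-lookup; ∈-allFin)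
open import Data.Product using (Σ; ∃-syntax; _×_; _,_; proj₁; proj₂)
open import Data.Bool using (true; false)
open import Data.Empty using (⊥-elim)
open import Function using (_∘_)
open import Function.Definitions using (Injective)
open import Relation.Binary.Definitions using (DecidableEquality)
open import Relation.Binary.PropositionalEquality as ≡ using (_≡_; refl; trans; cong; subst; subst₂)
open import Relation.Nullary using (¬_; yes; no; does; ¬?)

module _ {A B : Set} (_≟B_ : DecidableEquality B) (h : A → B) where

  fibre : B → List A → List A
  fibre b = filter (λ x → h x ≟B b)

  fibreᶜ : B → List A → List A
  fibreᶜ b = filter (λ x → ¬? (h x ≟B b))

  length-fibre+length-fibreᶜ : ∀ b xs → length (fibre b xs) + length (fibreᶜ b xs) ≡ length xs
  length-fibre+length-fibreᶜ b [] = refl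
  length-fibre+length-fibreᶜ b (x ∷ xs) with does (h x ≟B b)
  ... | true  = cong suc (length-fibre+length-fibreᶜ b xs)
  ... | false = trans (+-suc _ _) (cong suc (length-fibre+length-fibreᶜ b xs))

  length-fibre-mono : ∀ b {ys xs} → ys ⊆ xs → length (fibre b ys) ≤ length (fibre b xs)
  length-fibre-mono b ys⊆xs = Sublist.length-mono-≤ (Sublist.filter⁺ _ _ (λ { refl hx≡b → hx≡b }) ys⊆xs)

  image-fibreᶜ⊆tail : ∀ {b bs xs} → All (λ x → h x ∈ b ∷ bs) xs → All (λ x → h x ∈ bs) (fibreᶜ b xs)
  image-fibreᶜ⊆tail {xs = xs} xs⊆b∷bs = All.map drop-b (All.zip (filter⁺ _ xs⊆b∷bs , all-filter _ xs))
    where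
      drop-b : ∀ {x b bs} → h x ∈ b ∷ bs × ¬ h x ≡ b → h x ∈ bs
      drop-b (here hx≡b , hx≢b) = ⊥-elim (hx≢b hx≡b)
      drop-b (there hx∈bs , _)  = hx∈bs

  length-fibreᶜ> : ∀ {T m} b xs → length (fibre b xs) ≤ T → T + m < length xs → m < length (fibreᶜ b xs)
  length-fibreᶜ> b xs |fibre|≤T T+m<|xs| = ≰⇒> λ |fibreᶜ|≤m → <⇒≱ T+m<|xs|
    (≤-trans (≤-reflexive (≡.sym (length-fibre+length-fibreᶜ b xs))) (+-mono-≤ |fibre|≤T |fibreᶜ|≤m))

  pigeonhole : ∀ T (bs : List B) {xs : List A} → All (λ x → h x ∈ bs) xs →
               length bs * T < length xs → ∃[ b ] T < length (fibre b xs)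
  pigeonhole T [] {_ ∷ _} (() ∷ _) _
  pigeonhole T (b ∷ bs) {xs} xs⊆b∷bs |b∷bs|*T<|xs| with T <? length (fibre b xs)
  ... | yes T<|fibre| = b , T<|fibre|
  ... | no  T≮|fibre|
    with b′ , T<|fibre′| ← pigeonhole T bs (image-fibreᶜ⊆tail xs⊆b∷bs)
                             (length-fibreᶜ> b xs (≮⇒≥ T≮|fibre|) |b∷bs|*T<|xs|)
    = b′ , ≤-trans T<|fibre′| (length-fibre-mono b′ (Sublist.filter-⊆ _ xs))

lookup-injective : ∀ {A : Set} {xs : List A} → Unique xs → Injective _≡_ _≡_ (lookup xs)
lookup-injective (_ ∷ _)         {zero}  {zero}  _       = refl
lookup-injective (x∉xs ∷ _)      {zero}  {suc j} x≡xsⱼ   = ⊥-elim (All.lookup x∉xs (∈-lookup j) x≡xsⱼ)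
lookup-injective (x∉xs ∷ _)      {suc i} {zero}  xsᵢ≡x   = ⊥-elim (All.lookup x∉xs (∈-lookup i) (≡.sym xsᵢ≡x))
lookup-injective (_ ∷ xs-unique) {suc i} {suc j} xsᵢ≡xsⱼ = cong suc (lookup-injective xs-unique xsᵢ≡xsⱼ)

Unique⇒Fin-injection : ∀ {A : Set} {n} {xs : List A} → Unique xs → n ≤ length xs →
                       Σ (Fin n → A) λ f → Injective _≡_ _≡_ f × (∀ i → f i ∈ xs)
Unique⇒Fin-injection {xs = xs} xs-unique n≤|xs| =
  (λ i → lookup xs (inject≤ i n≤|xs|)) ,
  inject≤-injective _ _ _ _ ∘ lookup-injective xs-unique ,
  (λ i → ∈-lookup _)

length-allFin : ∀ n → length (allFin n) ≡ n
length-allFin n = length-tabulate (λ i → i)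

pigeonhole-Fin : ∀ {m k} T (h : Fin m → Fin k) → T * k < m →
                 ∃[ j ] Σ (Fin (suc T) → Fin m) λ f → Injective _≡_ _≡_ f × (∀ i → h (f i) ≡ j)
pigeonhole-Fin {m} {k} T h T*k<m
  with j , T<|fibre| ← pigeonhole _≟_ h T (allFin k) (tabulate⁺ (∈-allFin ∘ h))
                         (subst₂ _<_ (trans (*-comm T k) (cong (_* T) (≡.sym (length-allFin k))))
                                     (≡.sym (length-allFin m)) T*k<m)
  with f , f-injective , f∈fibre ← Unique⇒Fin-injection (Unique.filter⁺ _ (Unique.allFin⁺ m)) T<|fibre|
  = j , f , f-injective , (λ i → All.lookup (all-filter _ (allFin m)) (f∈fibre i))

DegreeAtLeast : ∀ {n} → Graph n → Fin n → ℕ → Set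
DegreeAtLeast {n} G v d = Σ (Fin d → Fin n) λ g → Injective _≡_ _≡_ g × (∀ i → Adj G v (g i))

module _ {n} (G : Graph n) where

  sees-all-other-colours⇒degree≥ : ∀ {b} (c : Fin n → Fin (suc b)) {v} i →
    (∀ j → ¬ j ≡ i → Σ (Fin n) λ u → Adj G v u × c u ≡ j) → DegreeAtLeast G v b
  sees-all-other-colours⇒degree≥ {b} c {v} i sees = neighbour , neighbour-injective , neighbour-adj
    where
      sees-punchIn : ∀ j → Σ (Fin n) λ u → Adj G v u × c u ≡ punchIn i j
      sees-punchIn j = sees (punchIn i j) (punchInᵢ≢i i j)
      neighbour : Fin b → Fin n
      neighbour = proj₁ ∘ sees-punchIn
      neighbour-adj : ∀ j → Adj G v (neighbour j)
      neighbour-adj = proj₁ ∘ proj₂ ∘ sees-punchIn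
      neighbour-colour : ∀ j → c (neighbour j) ≡ punchIn i j
      neighbour-colour = proj₂ ∘ proj₂ ∘ sees-punchIn
      neighbour-injective : Injective _≡_ _≡_ neighbour
      neighbour-injective {j} {j′} same = punchIn-injective i j j′
        (trans (≡.sym (neighbour-colour j)) (trans (cong c same) (neighbour-colour j′)))

  K1-Free⇒degree≤ : ∀ T → K1-Free G (suc T) → ∀ {k} (κ : Fin n → Fin k) → IsProperColoring G κ →
                    ∀ {v d} → DegreeAtLeast G v d → d ≤ T * (k ∸ 1)
  K1-Free⇒degree≤ T free {zero} κ _ {v} _ with () ← κ v
  K1-Free⇒degree≤ T free {suc k} κ κ-proper {v} {d} (g , g-injective , g-adj) = ≮⇒≥ (free ∘ star)
    where
      avoids-κv : ∀ i → ¬ κ v ≡ κ (g i)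
      avoids-κv i = κ-proper v (g i) (g-adj i)
      colour : Fin d → Fin k
      colour i = punchOut (avoids-κv i)
      star : T * k < d → HasInducedStar G (suc T)
      star T*k<d with j , f , f-injective , colour∘f≡j ← pigeonhole-Fin T colour T*k<d
        = v , g ∘ f , f-injective ∘ g-injective , g-adj ∘ f , independent
        where
          independent : ∀ i i′ → ¬ Adj G (g (f i)) (g (f i′))
          independent i i′ adj = κ-proper _ _ adj (punchOut-injective (avoids-κv (f i)) (avoids-κv (f i′))
            (trans (colour∘f≡j i) (≡.sym (colour∘f≡j i′))))

theorem1 : (t : ℕ) → 3 ≤ t → (n : ℕ) (G : Graph n) → K1-Free G t →
    (χ φ : ℕ) → IsChromaticNumber G χ → IsBChromaticNumber G φ →
    φ ≤ (t ∸ 1) * (χ ∸ 1) + 1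
theorem1 zero () _ _ _ _ _ _ _
theorem1 (suc T) _ _ _ _ _ zero _ _ = z≤n
theorem1 (suc T) _ _ G free χ (suc b) ((κ , κ-proper) , _) ((c , _ , _ , representative) , _)
  with _ , _ , sees ← representative zero
  = subst (suc b ≤_) (+-comm 1 (T * (χ ∸ 1)))
      (s≤s (K1-Free⇒degree≤ G T free κ κ-proper (sees-all-other-colours⇒degree≥ G c zero sees)))
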